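{- Let $G$ be a directed graph without multiedges, $s,t$ nodes of $G$, and $B$ its $s$-$t$ bridge sequence. A substring $L$ of $B$ is safe under the $s$-$t$ trails model if and only if $L$ has no trail breaker, i.e. there is no pair of consecutive edges $e_i,e_{i+1}$ of $L$ together with a non-empty path from $\mathrm{head}(e_i)$ to $\mathrm{tail}(e_{i+1})$ that uses neither $e_i$ nor $e_{i+1}$.
   Context: An $s$-$t$ bridge is an edge whose removal leaves no $s$-$t$ path; all $s$-$t$ bridges appear on every $s$-$t$ path in the same order, and $B$ is the sequence of $s$-$t$ bridges in this order. For an edge $e=(u,v)$, $\mathrm{tail}(e)=u$, $\mathrm{head}(e)=v$. A trail is a walk repeating no edge (nodes may repeat). A sequence of edges is safe under the $s$-$t$ trails model if it is a substring (contiguous) of the edge sequence of every $s$-$t$ trail of $G$. A path from a node to itself (when $\mathrm{head}(e_i)=\mathrm{tail}(e_{i+1})$) is a cycle. -}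

module Defs where

open import Data.Nat using (ℕ)
open import Data.Fin using (Fin)
open import Data.Product using (_×_; _,_; Σ; ∃; ∃-syntax; proj₁; proj₂)
open import Data.List using (List; []; _∷_; map)
open import Data.List.Membership.Propositional using (_∈_; _∉_)
open import Data.List.Relation.Unary.Unique.Propositional using (Unique)
open import Data.List.Relation.Unary.All using (All)
open import Data.List.Relation.Binary.Sublist.Propositional using (_⊆_)
open import Data.List.Relation.Binary.Infix.Heterogeneous using (Infix)
open import Relation.Binary.PropositionalEquality using (_≡_; _≢_)
open import Function.Bundles using (_⇔_)
open import Relation.Nullary using (¬_)

-- A directed graph without multiedges on node set Fin n:
-- an edge (u , v) goes from u to v; the edge list has no duplicates.
-- (Self-loops are allowed.)
Edge : ℕ → Set
Edge n = Fin n × Fin n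

tail head : ∀ {n} → Edge n → Fin n
tail = proj₁
head = proj₂

record Graph (n : ℕ) : Set where
  field
    edges  : List (Edge n)
    simple : Unique edges
open Graph public

_isSubstringOf_ : ∀ {a} {A : Set a} → List A → List A → Set a
xs isSubstringOf ys = Infix _≡_ xs ys

data Walk {n} (G : Graph n) : Fin n → Fin n → List (Edge n) → Set where
  []  : ∀ {u} → Walk G u u []
  _∷_ : ∀ {u w v es} → (u , w) ∈ edges G → Walk G w v es
      → Walk G u v ((u , w) ∷ es)

Trail : ∀ {n} → Graph n → Fin n → Fin n → List (Edge n) → Set
Trail G u v es = Walk G u v es × Unique es

-- Path: walk repeating no node, except that the first node may equal the
-- last one (then it is a cycle).  For node sequence v0 … vk this says
-- v0 … v(k-1) are distinct and v1 … vk are distinct.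
Path : ∀ {n} → Graph n → Fin n → Fin n → List (Edge n) → Set
Path G u v es = Walk G u v es × Unique (map tail es) × Unique (map head es)

IsBridge : ∀ {n} → Graph n → Fin n → Fin n → Edge n → Set
IsBridge G s t e =
  e ∈ edges G × (∀ es → Path G s t es → ¬ All (λ f → f ≢ e) es)

IsBridgeSeq : ∀ {n} → Graph n → Fin n → Fin n → List (Edge n) → Set
IsBridgeSeq G s t B =
  (∀ e → e ∈ B ⇔ IsBridge G s t e) ×
  (∀ es → Path G s t es → B ⊆ es)

SafeTrails : ∀ {n} → Graph n → Fin n → Fin n → List (Edge n) → Set
SafeTrails G s t L = ∀ es → Trail G s t es → L isSubstringOf es

HasTrailBreaker : ∀ {n} → Graph n → List (Edge n) → Set
HasTrailBreaker G L =
  ∃[ e₁ ] ∃[ e₂ ] ((e₁ ∷ e₂ ∷ []) isSubstringOf L ×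
    ∃[ p ] (Path G (head e₁) (tail e₂) p × p ≢ [] × e₁ ∉ p × e₂ ∉ p))

-- Every s-t walk contains an s-t path, so it contains B, and hence L, as a subsequence.  If in
-- an s-t trail two consecutive edges a, b of L are not adjacent, the part of the trail between
-- them shortens to a trail breaker.  Conversely, let P break the pair e₁ e₂ and let
-- Q = Q₁ e₁ e₂ Q₂ be an s-t path.  Then Q₁ e₁ P e₂ Q₂ is a trail: an edge shared by P and Q₁
-- (or Q₂) would splice into an s-t walk avoiding the bridge e₁ (or e₂).  In this trail e₁ is
-- not followed by e₂, so L is not safe.

module Submission where

open import Defs
open import Data.Fin using (Fin; _≟_)
open import Data.Product using (_×_; _,_; proj₁; proj₂; ∃₂; ∃-syntax)
open import Data.Sum using (_⊎_; inj₁; inj₂; [_,_]′)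
open import Data.Empty using (⊥-elim)
open import Data.List using (List; []; _∷_; _++_; map)
open import Data.List.Properties using (map-++)
open import Data.List.Membership.Propositional using (_∈_; _∉_)
open import Data.List.Membership.Propositional.Properties
  using (∈-++⁺ˡ; ∈-++⁺ʳ; ∈-++⁻; ∈-∃++; ∈-map⁻)
import Data.List.Membership.DecPropositional as DecMembership
open import Data.List.Relation.Unary.Any using (here; there)
open import Data.List.Relation.Unary.All using ([])
open import Data.List.Relation.Unary.All.Properties using (¬Any⇒All¬; All¬⇒¬Any)
open import Data.List.Relation.Unary.AllPairs using ([]; _∷_)
import Data.List.Relation.Unary.AllPairs.Properties as AllPairs
open import Data.List.Relation.Unary.Unique.Propositional using (Unique)
open import Data.List.Relation.Unary.Unique.Propositional.Properties using (Unique[x∷xs]⇒x∉xs)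
import Data.List.Relation.Unary.Unique.Propositional.Properties as Unique
open import Data.List.Relation.Binary.Disjoint.Propositional using (Disjoint)
open import Data.List.Relation.Binary.Disjoint.Propositional.Properties using (Disjoint⇒AllAll)
open import Data.List.Relation.Binary.Pointwise using (Pointwise-≡⇒≡)
open import Data.List.Relation.Binary.Prefix.Heterogeneous using (Prefix; []; _∷_)
open import Data.List.Relation.Binary.Infix.Heterogeneous
  using (Infix; here; there; toView; MkView; _++ⁱ_)
import Data.List.Relation.Binary.Infix.Heterogeneous.Properties as Infix
open import Data.List.Relation.Binary.Sublist.Propositional
  using (_⊆_; []; _∷_; _∷ʳ_; ⊆-refl; ⊆-trans; lookup; minimum)
open import Data.List.Relation.Binary.Sublist.Propositional.Properties using (++⁺ˡ; ++⁺ʳ)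
open import Data.List.Relation.Binary.Permutation.Propositional using (_↭_; ↭-trans; ↭⇒↭ₛ)
import Data.List.Relation.Binary.Permutation.Propositional.Properties as Perm
import Data.List.Relation.Binary.Permutation.Setoid.Properties as PermSetoid
open import Relation.Binary.PropositionalEquality using (_≡_; _≢_; refl; sym; trans; setoid)
open import Relation.Nullary using (¬_; yes; no)
open import Function using (_∘′_)
open import Function.Bundles using (_⇔_; mk⇔)

module _ {A : Set} where

  Infix-split : ∀ {xs ys : List A} → Infix _≡_ xs ys → ∃₂ λ p q → ys ≡ p ++ xs ++ q
  Infix-split inf with MkView p eq q ← toView inf rewrite Pointwise-≡⇒≡ eq = p , q , refl

  Infix-trans : ∀ {xs ys zs : List A} → Infix _≡_ xs ys → Infix _≡_ ys zs → Infix _≡_ xs zs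
  Infix-trans = Infix.trans trans

  Infix⇒⊆ : ∀ {xs ys : List A} → Infix _≡_ xs ys → xs ⊆ ys
  Infix⇒⊆ inf with p , q , refl ← Infix-split inf = ++⁺ˡ p (++⁺ʳ q ⊆-refl)

  Infix-pair⇒∈ : ∀ {x y} {zs : List A} → Infix _≡_ (x ∷ y ∷ []) zs → x ∈ zs × y ∈ zs
  Infix-pair⇒∈ inf = lookup (Infix⇒⊆ inf) (here refl) , lookup (Infix⇒⊆ inf) (there (here refl))

  ∉-++⁺ : ∀ {x} {xs ys : List A} → x ∉ xs → x ∉ ys → x ∉ xs ++ ys
  ∉-++⁺ {xs = xs} x∉xs x∉ys x∈ = [ x∉xs , x∉ys ]′ (∈-++⁻ xs x∈)

  Unique-++⁻ʳ : ∀ (xs : List A) {ys} → Unique (xs ++ ys) → Unique ys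
  Unique-++⁻ʳ []       u       = u
  Unique-++⁻ʳ (_ ∷ xs) (_ ∷ u) = Unique-++⁻ʳ xs u

  Unique-++⇒Disjoint : ∀ (xs : List A) {ys} → Unique (xs ++ ys) → Disjoint xs ys
  Unique-++⇒Disjoint (_ ∷ xs) u       (here refl , x∈ys) = Unique[x∷xs]⇒x∉xs u (∈-++⁺ʳ xs x∈ys)
  Unique-++⇒Disjoint (_ ∷ xs) (_ ∷ u) (there v∈xs , v∈ys) = Unique-++⇒Disjoint xs u (v∈xs , v∈ys)

  Unique-insert : ∀ (xs : List A) {y ys zs} → Unique (xs ++ y ∷ zs) → Unique ys
                → Disjoint ys (xs ++ y ∷ zs) → Unique (xs ++ y ∷ ys ++ zs)
  Unique-insert xs {y} {ys} {zs} u uys ys#xs =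
    PermSetoid.Unique-resp-↭ (setoid A) (↭⇒↭ₛ moved)
      (AllPairs.++⁺ uys u (Disjoint⇒AllAll ys#xs))
    where
    moved : ys ++ xs ++ y ∷ zs ↭ xs ++ y ∷ ys ++ zs
    moved = ↭-trans (Perm.shifts ys xs) (Perm.++⁺ˡ xs (Perm.shift y ys zs))

  successor-unique : ∀ {x y z} {zs : List A} → Unique zs
                   → Infix _≡_ (x ∷ y ∷ []) zs → Infix _≡_ (x ∷ z ∷ []) zs → y ≡ z
  successor-unique _ (here (refl ∷ refl ∷ [])) (here (refl ∷ refl ∷ [])) = refl
  successor-unique u (here (refl ∷ _)) (there inf) =
    ⊥-elim (Unique[x∷xs]⇒x∉xs u (proj₁ (Infix-pair⇒∈ inf)))
  successor-unique u (there inf) (here (refl ∷ _)) =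
    ⊥-elim (Unique[x∷xs]⇒x∉xs u (proj₁ (Infix-pair⇒∈ inf)))
  successor-unique (_ ∷ u) (there inf) (there inf′) = successor-unique u inf inf′

  record Gap (xs ys : List A) : Set where
    constructor gap
    field
      {x y}       : A
      consecutive : Infix _≡_ (x ∷ y ∷ []) xs
      before      : List A
      skipped     : List A
      after       : List A
      skipped≢[]  : skipped ≢ []
      split       : ys ≡ before ++ x ∷ skipped ++ y ∷ after

  Gap-there : ∀ {w} {xs ys : List A} → Gap xs ys → Gap xs (w ∷ ys)
  Gap-there (gap c b s a s≢[] refl) = gap c (_ ∷ b) s a s≢[] refl

  Gap-∷ : ∀ {w} {xs ys : List A} → Gap xs ys → Gap (w ∷ xs) (w ∷ ys)
  Gap-∷ (gap c b s a s≢[] refl) = gap (there c) (_ ∷ b) s a s≢[] refl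

  ∷⊆∷⇒Prefix⊎Gap : ∀ {w} {xs ys : List A} → xs ⊆ ys
                 → Prefix _≡_ (w ∷ xs) (w ∷ ys) ⊎ Gap (w ∷ xs) (w ∷ ys)
  ∷⊆∷⇒Prefix⊎Gap {xs = []} _ = inj₁ (refl ∷ [])
  ∷⊆∷⇒Prefix⊎Gap {xs = _ ∷ _} (y ∷ʳ σ) with C , rest , refl ← ∈-∃++ (lookup σ (here refl)) =
    inj₂ (gap (here (refl ∷ refl ∷ [])) [] (y ∷ C) rest (λ ()) refl)
  ∷⊆∷⇒Prefix⊎Gap (refl ∷ σ) with ∷⊆∷⇒Prefix⊎Gap σ
  ... | inj₁ pre = inj₁ (refl ∷ pre)
  ... | inj₂ g   = inj₂ (Gap-∷ g)

  ⊆⇒Infix⊎Gap : ∀ {xs ys : List A} → xs ⊆ ys → Infix _≡_ xs ys ⊎ Gap xs ys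
  ⊆⇒Infix⊎Gap {xs = []} _ = inj₁ (here [])
  ⊆⇒Infix⊎Gap (_ ∷ʳ σ) with ⊆⇒Infix⊎Gap σ
  ... | inj₁ inf = inj₁ (there inf)
  ... | inj₂ g   = inj₂ (Gap-there g)
  ⊆⇒Infix⊎Gap (refl ∷ σ) with ∷⊆∷⇒Prefix⊎Gap σ
  ... | inj₁ pre = inj₁ (here pre)
  ... | inj₂ g   = inj₂ g

module _ {n} {G : Graph n} where

  open DecMembership (_≟_ {n}) using (_∈?_)

  walk-++ : ∀ {u m v xs ys} → Walk G u m xs → Walk G m v ys → Walk G u v (xs ++ ys)
  walk-++ []       W′ = W′
  walk-++ (e∈ ∷ W) W′ = e∈ ∷ walk-++ W W′

  walk-split : ∀ xs {e ys u v} → Walk G u v (xs ++ e ∷ ys)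
             → Walk G u (tail e) xs × e ∈ edges G × Walk G (head e) v ys
  walk-split []       (e∈ ∷ W) = [] , e∈ , W
  walk-split (_ ∷ xs) (e∈ ∷ W) with W₁ , f∈ , W₂ ← walk-split xs W = e∈ ∷ W₁ , f∈ , W₂

  Path⇒Trail : ∀ {u v es} → Path G u v es → Trail G u v es
  Path⇒Trail (W , tails , _) = W , Unique.map⁻ tails

  visited-never-left⇒end : ∀ {u v x es} → Walk G u v es
                         → x ∈ u ∷ map head es → x ∉ map tail es → x ≡ v
  visited-never-left⇒end []      (here refl) _    = refl
  visited-never-left⇒end (_ ∷ _) (here refl) left = ⊥-elim (left (here refl))
  visited-never-left⇒end (_ ∷ W) (there x∈) left  = visited-never-left⇒end W x∈ (left ∘′ there)

  returns-to-start⇒closed : ∀ {w v P} → Path G w v P → w ∈ map head P → w ≡ v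
  returns-to-start⇒closed (_ ∷ W , w∉ ∷ _ , _) w∈ = visited-never-left⇒end W w∈ (All¬⇒¬Any w∉)

  path-suffix-from : ∀ {u v x P} → Path G u v P → x ∈ map tail P
                   → ∃[ R ] Path G x v R × R ⊆ P × R ≢ []
  path-suffix-from (W , tails , heads) x∈ with e , e∈P , refl ← ∈-map⁻ tail x∈
    with ys , zs , refl ← ∈-∃++ e∈P with _ , e∈ , W₂ ← walk-split ys W =
    e ∷ zs , (e∈ ∷ W₂ , suffix tail tails , suffix head heads) , ++⁺ˡ ys ⊆-refl , λ ()
    where
    suffix : (f : Edge n → Fin n) → Unique (map f (ys ++ e ∷ zs)) → Unique (map f (e ∷ zs))
    suffix f u rewrite map-++ f ys (e ∷ zs) = Unique-++⁻ʳ (map f ys) u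

  path-∷ : ∀ {u w v P} → (u , w) ∈ edges G → Path G w v P
         → ∃[ R ] Path G u v R × R ⊆ (u , w) ∷ P × R ≢ []
  path-∷ {u} {w} {P = P} uw∈ path@(W , tails , heads) with u ∈? map tail P | w ∈? map head P
  ... | yes u∈ | _ with R , pathR , R⊆ , R≢[] ← path-suffix-from path u∈ =
    R , pathR , _ ∷ʳ R⊆ , R≢[]
  ... | no _   | yes w∈ with refl ← returns-to-start⇒closed path w∈ =
    (u , w) ∷ [] , (uw∈ ∷ [] , [] ∷ [] , [] ∷ []) , refl ∷ minimum P , λ ()
  ... | no u∉  | no w∉ =
    (u , w) ∷ P , (uw∈ ∷ W , ¬Any⇒All¬ _ u∉ ∷ tails , ¬Any⇒All¬ _ w∉ ∷ heads) ,
    refl ∷ ⊆-refl , λ ()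

  walk⇒path : ∀ {u v es} → Walk G u v es → ∃[ P ] Path G u v P × P ⊆ es
  ∷-walk⇒path : ∀ {u v e es} → Walk G u v (e ∷ es)
              → ∃[ P ] Path G u v P × P ⊆ e ∷ es × P ≢ []

  walk⇒path [] = [] , ([] , [] , []) , []
  walk⇒path W@(_ ∷ _) with P , path , P⊆ , _ ← ∷-walk⇒path W = P , path , P⊆

  ∷-walk⇒path (uw∈ ∷ W) with P , path , P⊆ ← walk⇒path W
    with R , pathR , R⊆ , R≢[] ← path-∷ uw∈ path = R , pathR , ⊆-trans R⊆ (refl ∷ P⊆) , R≢[]

  crossing-walk : ∀ {u m m′ v X Y f} → Walk G u m X → Walk G m′ v Y → f ∈ X → f ∈ Y
                → ∃[ Z ] Walk G u v Z × (∀ {e} → e ∈ Z → e ∈ X ⊎ e ∈ Y)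
  crossing-walk {f = f} WX WY f∈X f∈Y
    with X₁ , X₂ , refl ← ∈-∃++ f∈X with Y₁ , Y₂ , refl ← ∈-∃++ f∈Y
    with WX₁ , f∈E , _ ← walk-split X₁ WX with _ , _ , WY₂ ← walk-split Y₁ WY =
    X₁ ++ f ∷ Y₂ , walk-++ WX₁ (f∈E ∷ WY₂) , from-X-or-Y
    where
    from-X-or-Y : ∀ {e} → e ∈ X₁ ++ f ∷ Y₂ → e ∈ X₁ ++ f ∷ X₂ ⊎ e ∈ Y₁ ++ f ∷ Y₂
    from-X-or-Y e∈ with ∈-++⁻ X₁ e∈
    ... | inj₁ e∈X₁         = inj₁ (∈-++⁺ˡ e∈X₁)
    ... | inj₂ (here refl)  = inj₁ (∈-++⁺ʳ X₁ (here refl))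
    ... | inj₂ (there e∈Y₂) = inj₂ (∈-++⁺ʳ Y₁ (there e∈Y₂))

module _ {n} {G : Graph n} {s t : Fin n} {B : List (Edge n)}
         (B⊆paths : ∀ es → Path G s t es → B ⊆ es) where

  B⊆walk : ∀ {es} → Walk G s t es → B ⊆ es
  B⊆walk W with P , path , P⊆ ← walk⇒path W = ⊆-trans (B⊆paths P path) P⊆

  bridge-separates : ∀ {e m m′ X Y} → e ∈ B → Walk G s m X → Walk G m′ t Y
                   → e ∉ X → e ∉ Y → Disjoint X Y
  bridge-separates e∈B WX WY e∉X e∉Y (f∈X , f∈Y)
    with Z , WZ , Z⊆X⊎Y ← crossing-walk WX WY f∈X f∈Y =
    [ e∉X , e∉Y ]′ (Z⊆X⊎Y (lookup (B⊆walk WZ) e∈B))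

  detour-trail : ∀ {Q₁ e₁ e₂ Q₂ P} → e₁ ∈ B → e₂ ∈ B → Trail G s t (Q₁ ++ e₁ ∷ e₂ ∷ Q₂)
               → Path G (head e₁) (tail e₂) P → e₁ ∉ P → e₂ ∉ P
               → Trail G s t (Q₁ ++ e₁ ∷ P ++ e₂ ∷ Q₂)
  detour-trail {Q₁} {e₁} {e₂} {Q₂} {P} e₁∈B e₂∈B (W , u) pathP e₁∉P e₂∉P
    with WQ₁ , e₁∈E , W′ ← walk-split Q₁ W with _ , e₂∈E , WQ₂ ← walk-split [] W′ =
    walk-++ WQ₁ (e₁∈E ∷ WP++e₂∷Q₂) , Unique-insert Q₁ u (proj₂ (Path⇒Trail pathP)) P#Q
    where
    WP = proj₁ pathP
    WP++e₂∷Q₂ = walk-++ WP (e₂∈E ∷ WQ₂)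
    Q₁#e₁e₂Q₂ : Disjoint Q₁ (e₁ ∷ e₂ ∷ Q₂)
    Q₁#e₁e₂Q₂ = Unique-++⇒Disjoint Q₁ u
    e₁∉e₂∷Q₂ : e₁ ∉ e₂ ∷ Q₂
    e₁∉e₂∷Q₂ = Unique[x∷xs]⇒x∉xs (Unique-++⁻ʳ Q₁ u)
    e₂∉Q₂ : e₂ ∉ Q₂
    e₂∉Q₂ = Unique[x∷xs]⇒x∉xs (Unique-++⁻ʳ (e₁ ∷ []) (Unique-++⁻ʳ Q₁ u))
    e₂∉e₁∷P : e₂ ∉ e₁ ∷ P
    e₂∉e₁∷P (here e₂≡e₁) = e₁∉e₂∷Q₂ (here (sym e₂≡e₁))
    e₂∉e₁∷P (there e₂∈P) = e₂∉P e₂∈P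
    P#Q : Disjoint P (Q₁ ++ e₁ ∷ e₂ ∷ Q₂)
    P#Q (v∈P , v∈Q) with ∈-++⁻ Q₁ v∈Q
    ... | inj₁ v∈Q₁ =
      bridge-separates e₁∈B WQ₁ WP++e₂∷Q₂ (λ e₁∈ → Q₁#e₁e₂Q₂ (e₁∈ , here refl))
        (∉-++⁺ e₁∉P e₁∉e₂∷Q₂) (v∈Q₁ , ∈-++⁺ˡ v∈P)
    ... | inj₂ (here refl)          = e₁∉P v∈P
    ... | inj₂ (there (here refl))  = e₂∉P v∈P
    ... | inj₂ (there (there v∈Q₂)) =
      bridge-separates e₂∈B (walk-++ WQ₁ (e₁∈E ∷ WP)) WQ₂
        (∉-++⁺ (λ e₂∈ → Q₁#e₁e₂Q₂ (e₂∈ , there (here refl))) e₂∉e₁∷P) e₂∉Q₂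
        (∈-++⁺ʳ Q₁ (there v∈P) , v∈Q₂)

  safe⇒no-breaker : ∀ {L} → L isSubstringOf B → ∃[ Q ] Path G s t Q
                  → SafeTrails G s t L → ¬ HasTrailBreaker G L
  safe⇒no-breaker _ _ _ (_ , _ , _ , [] , _ , []≢[] , _) = []≢[] refl
  safe⇒no-breaker L∞B (Q , pathQ) safe (e₁ , e₂ , e₁e₂∞L , g ∷ P , pathP , _ , e₁∉P , e₂∉P)
    with Q₁ , Q₂ , refl ← Infix-split (Infix-trans e₁e₂∞L (safe Q (Path⇒Trail pathQ)))
    with e₁∈B , e₂∈B ← Infix-pair⇒∈ (Infix-trans e₁e₂∞L L∞B)
    with T ← detour-trail e₁∈B e₂∈B (Path⇒Trail pathQ) pathP e₁∉P e₂∉P =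
    e₂∉P (here (sym g≡e₂))
    where
    g≡e₂ : g ≡ e₂
    g≡e₂ = successor-unique (proj₂ T) (Q₁ ++ⁱ here (refl ∷ refl ∷ []))
             (Infix-trans e₁e₂∞L (safe _ T))

  no-breaker⇒safe : ∀ {L} → L isSubstringOf B → ¬ HasTrailBreaker G L → SafeTrails G s t L
  no-breaker⇒safe L∞B no-breaker T (W , u) with ⊆⇒Infix⊎Gap (⊆-trans (Infix⇒⊆ L∞B) (B⊆walk W))
  ... | inj₁ L∞T = L∞T
  ... | inj₂ (gap _ _ [] _ []≢[] _) = ⊥-elim ([]≢[] refl)
  ... | inj₂ (gap {a} {b} ab∞L p (c ∷ C) q _ refl)
    with _ , _ , W′ ← walk-split p W with WC , _ ← walk-split (c ∷ C) W′
    with P , pathP , P⊆ , P≢[] ← ∷-walk⇒path WC =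
    ⊥-elim (no-breaker (a , b , ab∞L , P , pathP , P≢[] , a∉C ∘′ lookup P⊆ , b∉C ∘′ lookup P⊆))
    where
    u′ : Unique (a ∷ (c ∷ C) ++ b ∷ q)
    u′ = Unique-++⁻ʳ p u
    a∉C : a ∉ c ∷ C
    a∉C a∈ = Unique[x∷xs]⇒x∉xs u′ (∈-++⁺ˡ a∈)
    b∉C : b ∉ c ∷ C
    b∉C b∈ = Unique-++⇒Disjoint (c ∷ C) (Unique-++⁻ʳ (a ∷ []) u′) (b∈ , here refl)

theorem8 : ∀ {n} (G : Graph n) (s t : Fin n) (B : List (Edge n))
           → ∃[ es ] Path G s t es
           → IsBridgeSeq G s t B
           → (L : List (Edge n)) → L isSubstringOf B
           → SafeTrails G s t L ⇔ (¬ HasTrailBreaker G L)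
theorem8 G s t B path (_ , B⊆paths) L L∞B =
  mk⇔ (safe⇒no-breaker B⊆paths L∞B path) (no-breaker⇒safe B⊆paths L∞B)
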